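{- Let $\mathcal{S}_n^0$ be the set of all elements of $\mathcal{S}_n$ all of whose coordinates are nonzero. Then $\mathcal{S}_n^0$ is a minimal element of the poset $E(\mathcal{S}_n)$ (ordered by inclusion).
   Context: $\mathcal{S}_n$ is the set of nonzero tuples in $\{ -1,0,1\}^n$ whose first nonzero entry is $1$. A tuple $t\in\{1,0,-1,u\}^n$ eliminates $s\in\mathcal{S}_n$ if: (i) $t_i\neq0$ and $s_i\ne0$ for some $i$; (ii) there is $k\in\{+1,-1\}$ with $t_i=ks_i$ for all $i$ with $s_i\ne0$ and $t_i\ne0$; (iii) $s_i=0$ whenever $t_i=u$. For $X\subseteq\mathcal{S}_n$, $\mathcal{E}(X)$ is the set of elements of $\mathcal{S}_n$ eliminated by some element of $X$, and $E(\mathcal{S}_n)=\{X\subseteq\mathcal{S}_n:\mathcal{E}(X)=\mathcal{S}_n\}$. -}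

module Defs where

open import Data.Nat using (ℕ)
open import Data.Fin using (Fin)
open import Data.Vec using (Vec; []; _∷_; lookup)
open import Data.Bool using (Bool; true; false)
open import Data.Product using (Σ; ∃; _×_)
open import Relation.Binary.PropositionalEquality using (_≡_; _≢_)
open import Relation.Unary using (Pred; _⊆_)
open import Level using (0ℓ)

-- Symbols: p = 1, m = -1, z = 0, u = the extra symbol u.
data Sym : Set where
  p m z u : Sym

Tuple : ℕ → Set
Tuple n = Vec Sym n

-- multiplication by k ∈ {+1,-1}; k encoded as Bool (true = +1, false = -1)
scale : Bool → Sym → Sym
scale true  x = x
scale false p = m
scale false m = p
scale false z = z
scale false u = u

data NoU : ∀ {n} → Tuple n → Set where
  []  : NoU []
  _∷_ : ∀ {n x} {s : Tuple n} → x ≢ u → NoU s → NoU (x ∷ s)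

data FirstNonzeroOne : ∀ {n} → Tuple n → Set where
  here  : ∀ {n} {s : Tuple n} → FirstNonzeroOne (p ∷ s)
  there : ∀ {n} {s : Tuple n} → FirstNonzeroOne s → FirstNonzeroOne (z ∷ s)

InS : ∀ {n} → Pred (Tuple n) 0ℓ
InS s = NoU s × FirstNonzeroOne s

InS0 : ∀ {n} → Pred (Tuple n) 0ℓ
InS0 {n} s = InS s × (∀ (i : Fin n) → lookup s i ≢ z)

Eliminates : ∀ {n} → Tuple n → Tuple n → Set
Eliminates {n} t s =
  (∃ λ (i : Fin n) → lookup t i ≢ z × lookup s i ≢ z)
  × (∃ λ (k : Bool) → ∀ (i : Fin n) → lookup s i ≢ z → lookup t i ≢ z →
        lookup t i ≡ scale k (lookup s i))
  × (∀ (i : Fin n) → lookup t i ≡ u → lookup s i ≡ z)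

𝓔 : ∀ {n} → Pred (Tuple n) 0ℓ → Pred (Tuple n) 0ℓ
𝓔 X s = InS s × (∃ λ t → X t × Eliminates t s)

InE : ∀ {n} → Pred (Tuple n) 0ℓ → Set
InE X = (X ⊆ InS) × (𝓔 X ⊆ InS) × (InS ⊆ 𝓔 X)

MinimalInE : ∀ {n} → Pred (Tuple n) 0ℓ → Set₁
MinimalInE {n} X = InE X × (∀ (Y : Pred (Tuple n) 0ℓ) → InE Y → Y ⊆ X → X ⊆ Y)

-- Every s ∈ S_n is eliminated (with k = +1) by the tuple of S_n^0 obtained
-- by replacing each zero of s by 1, so S_n^0 ∈ E(S_n). Conversely, two tuples of S_n^0
-- have no zero entries, so one eliminates the other only if they agree up to a sign k;
-- both start with 1, forcing k = +1. Hence each s ∈ S_n^0 can only be eliminated by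
-- itself, and every Y ∈ E(S_n) with Y ⊆ S_n^0 must contain all of S_n^0.

module Submission where

open import Defs
open import Data.Nat using (ℕ; suc)
open import Data.Fin using (zero; suc)
open import Data.Vec using (Vec; []; _∷_; lookup; map; tabulate)
open import Data.Vec.Properties using (lookup-map; tabulate∘lookup; tabulate-cong)
open import Data.Bool using (true; false)
open import Data.Product using (∃; _×_; _,_; proj₁; proj₂)
open import Data.Empty using (⊥-elim)
open import Relation.Binary.PropositionalEquality
open import Relation.Unary using (_⊆_)

lookup-ext : ∀ {n} {A : Set} {xs ys : Vec A n} →
             (∀ i → lookup xs i ≡ lookup ys i) → xs ≡ ys
lookup-ext {xs = xs} {ys} eq = begin
  xs                   ≡⟨ sym (tabulate∘lookup xs) ⟩
  tabulate (lookup xs) ≡⟨ tabulate-cong eq ⟩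
  tabulate (lookup ys) ≡⟨ tabulate∘lookup ys ⟩
  ys                   ∎
  where open ≡-Reasoning

NoU-lookup : ∀ {n} {s : Tuple n} → NoU s → ∀ i → lookup s i ≢ u
NoU-lookup (x≢u ∷ _)  zero    = x≢u
NoU-lookup (_   ∷ nu) (suc i) = NoU-lookup nu i

FirstNonzeroOne⇒∃p : ∀ {n} {s : Tuple n} → FirstNonzeroOne s → ∃ λ i → lookup s i ≡ p
FirstNonzeroOne⇒∃p here      = zero , refl
FirstNonzeroOne⇒∃p (there f) with FirstNonzeroOne⇒∃p f
... | i , sᵢ≡p = suc i , sᵢ≡p

InS0-head : ∀ {n} {s : Tuple (suc n)} → InS0 s → lookup s zero ≡ p
InS0-head ((_ , here)    , _)       = refl
InS0-head ((_ , there _) , nonzero) = ⊥-elim (nonzero zero refl)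

fill : Sym → Sym
fill z = p
fill x = x

fill-≢z : ∀ x → fill x ≢ z
fill-≢z p ()
fill-≢z m ()
fill-≢z z ()
fill-≢z u ()

fill-≢z-id : ∀ {x} → x ≢ z → fill x ≡ x
fill-≢z-id {p} _   = refl
fill-≢z-id {m} _   = refl
fill-≢z-id {z} x≢z = ⊥-elim (x≢z refl)
fill-≢z-id {u} _   = refl

fill-≢u : ∀ {x} → x ≢ u → fill x ≢ u
fill-≢u {p} _   ()
fill-≢u {m} _   ()
fill-≢u {z} _   ()
fill-≢u {u} x≢u _ = x≢u refl

NoU-map-fill : ∀ {n} {s : Tuple n} → NoU s → NoU (map fill s)
NoU-map-fill []          = []
NoU-map-fill (x≢u ∷ nu) = fill-≢u x≢u ∷ NoU-map-fill nu

FirstNonzeroOne-map-fill : ∀ {n} {s : Tuple n} → FirstNonzeroOne s → FirstNonzeroOne (map fill s)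
FirstNonzeroOne-map-fill here      = here
FirstNonzeroOne-map-fill (there _) = here

lookup-fill : ∀ {n} (s : Tuple n) i → lookup (map fill s) i ≡ fill (lookup s i)
lookup-fill s i = lookup-map i fill s

map-fill-InS0 : ∀ {n} {s : Tuple n} → InS s → InS0 (map fill s)
map-fill-InS0 {s = s} (nu , f) =
  (NoU-map-fill nu , FirstNonzeroOne-map-fill f) ,
  λ i → subst (_≢ z) (sym (lookup-fill s i)) (fill-≢z (lookup s i))

map-fill-eliminates : ∀ {n} {s : Tuple n} → InS s → Eliminates (map fill s) s
map-fill-eliminates {s = s} (nu , f) = common-support , (true , agree) , u-only-on-zeros
  where
  common-support : ∃ λ i → lookup (map fill s) i ≢ z × lookup s i ≢ z
  common-support with FirstNonzeroOne⇒∃p f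
  ... | i , sᵢ≡p = i , subst (_≢ z) (sym (lookup-fill s i)) (fill-≢z (lookup s i))
                     , λ sᵢ≡z → p≢z (trans (sym sᵢ≡p) sᵢ≡z)
    where
    p≢z : p ≢ z
    p≢z ()

  agree : ∀ i → lookup s i ≢ z → lookup (map fill s) i ≢ z → lookup (map fill s) i ≡ lookup s i
  agree i sᵢ≢z _ = trans (lookup-fill s i) (fill-≢z-id sᵢ≢z)

  u-only-on-zeros : ∀ i → lookup (map fill s) i ≡ u → lookup s i ≡ z
  u-only-on-zeros i tᵢ≡u =
    ⊥-elim (fill-≢u (NoU-lookup nu i) (trans (sym (lookup-fill s i)) tᵢ≡u))

InS0-InE : ∀ {n} → InE {n} InS0
InS0-InE = proj₁ , proj₁ , λ {s} s∈S → s∈S , map fill s , map-fill-InS0 s∈S , map-fill-eliminates s∈S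

scale-fixes-p⇒+1 : ∀ k → p ≡ scale k p → k ≡ true
scale-fixes-p⇒+1 true  _  = refl
scale-fixes-p⇒+1 false ()

InS0-eliminates⇒≡ : ∀ {n} {t s : Tuple n} → InS0 t → InS0 s → Eliminates t s → t ≡ s
InS0-eliminates⇒≡ {t = []} {[]} _ _ _ = refl
InS0-eliminates⇒≡ {suc _} {t} {s} t⁰ s⁰ (_ , (k , agree) , _) =
  lookup-ext λ i → subst (λ k → lookup t i ≡ scale k (lookup s i)) k≡+1 (agree⁰ i)
  where
  agree⁰ : ∀ i → lookup t i ≡ scale k (lookup s i)
  agree⁰ i = agree i (proj₂ s⁰ i) (proj₂ t⁰ i)

  k≡+1 : k ≡ true
  k≡+1 = scale-fixes-p⇒+1 k
    (trans (sym (InS0-head t⁰)) (trans (agree⁰ zero) (cong (scale k) (InS0-head s⁰))))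

InE-⊆-InS0⇒⊇ : ∀ {n} {Y : Tuple n → Set} → InE Y → Y ⊆ InS0 → InS0 ⊆ Y
InE-⊆-InS0⇒⊇ {Y = Y} (_ , _ , covers) Y⊆S⁰ s⁰ with covers (proj₁ s⁰)
... | _ , t , t∈Y , t-elim-s = subst Y (InS0-eliminates⇒≡ (Y⊆S⁰ t∈Y) s⁰ t-elim-s) t∈Y

mainTheorem6 : ∀ (n : ℕ) → MinimalInE {n} InS0
mainTheorem6 _ = InS0-InE , λ _ → InE-⊆-InS0⇒⊇
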